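{- Let $n>1$, let $L_1,\dots,L_n$ be complete lattices, let $f:L_1\times\dots\times L_n\to L_1\times\dots\times L_n$ be monotone with coordinate projections $f_1,\dots,f_n$, let $B$ be a binding map on $\{1,\dots,n\}$, let $i,j\in\{1,\dots,n\}$ with $i\neq j$, and let $a_j\in L_j$. If $i<j$ then \[ \mathrm{nested}(n,i,B(j:=a_j),f)=\mathrm{nested}(n-1,i,\mathrm{Sp}_jB,\mathrm{Sp}_{j,a_j}f), \] and if $i>j$ then \[ \mathrm{nested}(n,i,B(j:=a_j),f)=\mathrm{nested}(n-1,i-1,\mathrm{Sp}_jB,\mathrm{Sp}_{j,a_j}f). \]
   Context: Nested fixpoints. For complete lattices $M_1,\dots,M_m$ and a monotone $g:M_1\times\dots\times M_m\to M_1\times\dots\times M_m$ with coordinate projections $g_k$, a "binding map" is a map $B:\{1,\dots,m\}\to(\bigsqcup_k M_k)\sqcup\{\mathrm{undef}\}$ with $B(k)\in M_k$ whenever $B(k)\neq\mathrm{undef}$. For $x\in M_i$, $B(i:=x)$ denotes the binding map sending $i$ to $x$ and every $k\neq i$ to $B(k)$. For $i\in\{1,\dots,m\}$ define recursively (by recursion on the number of $k$ with $B(k)=\mathrm{undef}$) \[ \mathrm{nested}(m,i,B,g)=\mu x_i.\, g_i(v(x_i)), \] where $\mu x_i.\,h(x_i)$ is the least fixpoint in $M_i$ of a monotone $h:M_i\to M_i$, and $v(x_i)$ is the vector whose $k$-th coordinate is: $x_i$ if $k=i$; otherwise $B(k)$ if $B(k)\neq\mathrm{undef}$; otherwise $\mathrm{nested}(m,k,B(i:=x_i),g)$.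 Specialization. Given $f$ on $L_1\times\dots\times L_n$, $j\in\{1,\dots,n\}$ and $a\in L_j$, for $\vec y=(y_1,\dots,y_{n-1})\in L_1\times\dots\times L_{j-1}\times L_{j+1}\times\dots\times L_n$ let $E_{j,a}\vec y=(y_1,\dots,y_{j-1},a,y_j,\dots,y_{n-1})\in L_1\times\dots\times L_n$. The specialization $\mathrm{Sp}_{j,a}f$ is the monotone self-map of the $(n-1)$-fold product $M_1\times\dots\times M_{n-1}$, where $M_h=L_h$ for $h<j$ and $M_h=L_{h+1}$ for $h\ge j$, with coordinates $(\mathrm{Sp}_{j,a}f)_h(\vec y)=f_h(E_{j,a}\vec y)$ for $h<j$ and $(\mathrm{Sp}_{j,a}f)_h(\vec y)=f_{h+1}(E_{j,a}\vec y)$ for $j\le h\le n-1$. For a binding map $B$ on $\{1,\dots,n\}$, $\mathrm{Sp}_jB$ is the binding map on $\{1,\dots,n-1\}$ with $(\mathrm{Sp}_jB)(h)=B(h)$ for $h<j$ and $(\mathrm{Sp}_jB)(h)=B(h+1)$ for $j\le h\le n-1$. -}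

module Defs where

open import Level using (Level; _⊔_) renaming (suc to lsuc)
open import Data.Nat using (ℕ; zero; suc; _+_)
open import Data.Fin using (Fin; zero; suc; _≟_; punchIn; punchOut)
open import Data.Fin.Properties using (punchIn-punchOut)
open import Data.Maybe using (Maybe; just; nothing; maybe′)
open import Data.Unit.Polymorphic using (⊤)
open import Relation.Binary.Bundles using (Poset)
open import Relation.Binary.PropositionalEquality using (_≡_; refl; subst)
open import Relation.Nullary using (yes; no)
open import Relation.Unary using (Pred)

-- A complete lattice: a poset in which every subset (predicate) has a meet.
-- (Arbitrary meets give arbitrary joins, so this is the usual notion.)
record CompleteLattice (c ℓ₁ ℓ₂ : Level) : Set (lsuc (c ⊔ ℓ₁ ⊔ ℓ₂)) where
  field
    poset : Poset c ℓ₁ ℓ₂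
  open Poset poset public
  field
    ⋀          : Pred Carrier ℓ₂ → Carrier
    ⋀-lower    : ∀ (P : Pred Carrier ℓ₂) {x} → P x → ⋀ P ≤ x
    ⋀-greatest : ∀ (P : Pred Carrier ℓ₂) {y} → (∀ {x} → P x → y ≤ x) → y ≤ ⋀ P

  ⊥ : Carrier
  ⊥ = ⋀ (λ _ → ⊤)

  -- least fixpoint μ x. h x, via Knaster–Tarski: meet of all pre-fixpoints
  μ : (Carrier → Carrier) → Carrier
  μ h = ⋀ (λ x → h x ≤ x)

open CompleteLattice public using (Carrier; ⋀; μ; ⊥)

module _ {c ℓ₁ ℓ₂ : Level} where

  Prod : ∀ {m} → (Fin m → CompleteLattice c ℓ₁ ℓ₂) → Set c
  Prod {m} L = (k : Fin m) → Carrier (L k)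

  _≤ₚ_ : ∀ {m} {L : Fin m → CompleteLattice c ℓ₁ ℓ₂} → Prod L → Prod L → Set ℓ₂
  _≤ₚ_ {L = L} x y = ∀ k → CompleteLattice._≤_ (L k) (x k) (y k)

  Monotone : ∀ {m} {L : Fin m → CompleteLattice c ℓ₁ ℓ₂} → (Prod L → Prod L) → Set (c ⊔ ℓ₂)
  Monotone {L = L} g = ∀ x y → _≤ₚ_ {L = L} x y → _≤ₚ_ {L = L} (g x) (g y)

  -- binding maps: nothing = undef
  Binding : ∀ {m} → (Fin m → CompleteLattice c ℓ₁ ℓ₂) → Set c
  Binding {m} L = (k : Fin m) → Maybe (Carrier (L k))

  bind : ∀ {m} {L : Fin m → CompleteLattice c ℓ₁ ℓ₂} →
         Binding L → (i : Fin m) → Carrier (L i) → Binding L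
  bind B i x k with i ≟ k
  ... | yes refl = just x
  ... | no _     = B k

  undefCount : ∀ {m} {L : Fin m → CompleteLattice c ℓ₁ ℓ₂} → Binding L → ℕ
  undefCount {zero}  B = 0
  undefCount {suc m} {L} B = here (B zero) + undefCount {m} {λ k → L (suc k)} (λ k → B (suc k))
    where
    here : Maybe (Carrier (L zero)) → ℕ
    here nothing  = 1
    here (just _) = 0

  -- nested fixpoints, by recursion on a fuel parameter; nested below supplies
  -- fuel 1 + (number of undefs), which is enough so that the fuel-0 clause is
  -- never reached (the recursion is really on the number of undefs).
  mutual
    nestedF : ∀ {m} (L : Fin m → CompleteLattice c ℓ₁ ℓ₂) (g : Prod L → Prod L) →
              ℕ → (i : Fin m) → Binding L → Carrier (L i)
    nestedF L g zero    i B = ⊥ (L i)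
    nestedF L g (suc f) i B = μ (L i) (λ x → g (vecF L g f i B x) i)

    vecF : ∀ {m} (L : Fin m → CompleteLattice c ℓ₁ ℓ₂) (g : Prod L → Prod L) →
           ℕ → (i : Fin m) → Binding L → Carrier (L i) → Prod L
    vecF L g f i B x k with i ≟ k
    ... | yes refl = x
    ... | no _     = maybe′ (λ b → b) (nestedF L g f k (bind {L = L} B i x)) (B k)

  nested : ∀ {m} (L : Fin m → CompleteLattice c ℓ₁ ℓ₂) (g : Prod L → Prod L) →
           (i : Fin m) → Binding L → Carrier (L i)
  nested L g i B = nestedF L g (suc (undefCount {L = L} B)) i B

  -- Specialization.  M_h = L_(punchIn j h), i.e. L_h for h < j and L_(h+1) for h ≥ j.
  SpL : ∀ {n} → (Fin (suc n) → CompleteLattice c ℓ₁ ℓ₂) → Fin (suc n) →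
        Fin n → CompleteLattice c ℓ₁ ℓ₂
  SpL L j h = L (punchIn j h)

  E : ∀ {n} (L : Fin (suc n) → CompleteLattice c ℓ₁ ℓ₂) (j : Fin (suc n)) →
      Carrier (L j) → Prod (SpL L j) → Prod L
  E L j a y k with j ≟ k
  ... | yes refl = a
  ... | no j≢k   = subst (λ k′ → Carrier (L k′)) (punchIn-punchOut j≢k) (y (punchOut j≢k))

  Sp : ∀ {n} (L : Fin (suc n) → CompleteLattice c ℓ₁ ℓ₂) (j : Fin (suc n)) →
       Carrier (L j) → (Prod L → Prod L) → Prod (SpL L j) → Prod (SpL L j)
  Sp L j a f y h = f (E L j a y) (punchIn j h)

  SpB : ∀ {n} {L : Fin (suc n) → CompleteLattice c ℓ₁ ℓ₂} (j : Fin (suc n)) →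
        Binding L → Binding (SpL L j)
  SpB j B h = B (punchIn j h)

{-# OPTIONS --safe #-}
module Submission where

-- Fixing B(j) = a removes exactly one undef, so both sides unfold with the
-- same fuel.  While B(j) = a and B′ = Sp_j B, the vector v(x) built for f
-- equals a at j and, off j, the vector v′(x) built for Sp_{j,a} f; that is,
-- v(x) ≈ E_{j,a} v′(x), so the two fixpoint operators agree and so do their
-- least fixpoints.  The invariant survives the inner binding B(i := x), so
-- induction on the fuel closes the argument.

open import Defs
open import Level using (Level)
open import Data.Nat using (ℕ; zero; suc; _+_; _<_)
open import Data.Fin using (Fin; zero; suc; _≟_; punchIn)
open import Data.Fin.Properties using (punchInᵢ≢i; punchIn-injective)
open import Data.Nat.Properties using (+-commutativeSemigroup)
open import Algebra.Properties.CommutativeSemigroup +-commutativeSemigroup using (x∙yz≈y∙xz)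
open import Data.Maybe using (Maybe; just; nothing; maybe′)
open import Data.Empty using (⊥-elim)
open import Function using (_∘_)
open import Relation.Binary.PropositionalEquality
  using (_≡_; _≢_; refl; sym; trans; cong; cong₂; subst; module ≡-Reasoning)
open import Relation.Nullary using (yes; no)

countUndef : ∀ {a} {A : Set a} → Maybe A → ℕ
countUndef nothing  = 1
countUndef (just _) = 0

module _ {c ℓ₁ ℓ₂ : Level} where

  module _ (C : CompleteLattice c ℓ₁ ℓ₂) where
    open CompleteLattice C hiding (⊥; ⋀; μ; Carrier) renaming (trans to ≤-trans)

    μ-cong : ∀ (h₁ h₂ : Carrier C → Carrier C) → (∀ x → h₁ x ≈ h₂ x) → μ C h₁ ≈ μ C h₂
    μ-cong h₁ h₂ h₁≈h₂ = antisym (pre-fixpoints h₁ h₂ h₁≈h₂)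
                                 (pre-fixpoints h₂ h₁ (Eq.sym ∘ h₁≈h₂))
      where
      pre-fixpoints : ∀ g h → (∀ x → g x ≈ h x) → μ C g ≤ μ C h
      pre-fixpoints g h g≈h =
        ⋀-greatest _ λ {x} hx≤x → ⋀-lower _ (≤-trans (reflexive (g≈h x)) hx≤x)

    maybe′-cong : ∀ (b : Maybe (Carrier C)) {d₁ d₂} → d₁ ≈ d₂ →
                  maybe′ (λ x → x) d₁ b ≈ maybe′ (λ x → x) d₂ b
    maybe′-cong (just _) _     = Eq.refl
    maybe′-cong nothing  d₁≈d₂ = d₁≈d₂

  module _ {m} {L : Fin m → CompleteLattice c ℓ₁ ℓ₂} where
    private module L k = CompleteLattice (L k)

    monotone⇒cong : ∀ (g : Prod L → Prod L) → Monotone {L = L} g →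
                    ∀ u v → (∀ k → L._≈_ k (u k) (v k)) → ∀ k → L._≈_ k (g u k) (g v k)
    monotone⇒cong g mono u v u≈v k =
      L.antisym k (mono u v (λ l → L.reflexive l (u≈v l)) k)
                  (mono v u (λ l → L.reflexive l (L.Eq.sym l (u≈v l))) k)

    bind-≡ : ∀ (B : Binding L) i x → bind {L = L} B i x i ≡ just x
    bind-≡ B i x with i ≟ i
    ... | yes refl = refl
    ... | no i≢i   = ⊥-elim (i≢i refl)

    bind-≢ : ∀ (B : Binding L) {i k} x → i ≢ k → bind {L = L} B i x k ≡ B k
    bind-≢ B {i} {k} x i≢k with i ≟ k
    ... | yes i≡k = ⊥-elim (i≢k i≡k)
    ... | no _    = refl

    vecF-≡ : ∀ (g : Prod L → Prod L) F i (B : Binding L) x → vecF L g F i B x i ≡ x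
    vecF-≡ g F i B x with i ≟ i
    ... | yes refl = refl
    ... | no i≢i   = ⊥-elim (i≢i refl)

    vecF-≢ : ∀ (g : Prod L → Prod L) F {i k} (B : Binding L) x → i ≢ k →
             vecF L g F i B x k ≡ maybe′ (λ b → b) (nestedF L g F k (bind {L = L} B i x)) (B k)
    vecF-≢ g F {i} {k} B x i≢k with i ≟ k
    ... | yes i≡k = ⊥-elim (i≢k i≡k)
    ... | no _    = refl

  undefCount-suc : ∀ {m} {L : Fin (suc m) → CompleteLattice c ℓ₁ ℓ₂} (B : Binding L) →
                   undefCount {L = L} B ≡ countUndef (B zero) + undefCount {L = L ∘ suc} (B ∘ suc)
  undefCount-suc B with B zero
  ... | nothing = refl
  ... | just _  = refl

  undefCount-cong : ∀ {m} {L : Fin m → CompleteLattice c ℓ₁ ℓ₂} (B₁ B₂ : Binding L) →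
                    (∀ k → B₁ k ≡ B₂ k) → undefCount {L = L} B₁ ≡ undefCount {L = L} B₂
  undefCount-cong {zero}  B₁ B₂ B₁≡B₂ = refl
  undefCount-cong {suc m} {L} B₁ B₂ B₁≡B₂ = begin
    undefCount {L = L} B₁
      ≡⟨ undefCount-suc B₁ ⟩
    countUndef (B₁ zero) + undefCount {L = L ∘ suc} (B₁ ∘ suc)
      ≡⟨ cong₂ (λ b n → countUndef b + n) (B₁≡B₂ zero)
               (undefCount-cong (B₁ ∘ suc) (B₂ ∘ suc) (B₁≡B₂ ∘ suc)) ⟩
    countUndef (B₂ zero) + undefCount {L = L ∘ suc} (B₂ ∘ suc)
      ≡⟨ sym (undefCount-suc B₂) ⟩
    undefCount {L = L} B₂
      ∎
    where open ≡-Reasoning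

  undefCount-punchIn : ∀ {m} {L : Fin (suc m) → CompleteLattice c ℓ₁ ℓ₂} (B : Binding L) j →
                       undefCount {L = L} B ≡ countUndef (B j) + undefCount {L = SpL L j} (SpB {L = L} j B)
  undefCount-punchIn B zero = undefCount-suc B
  undefCount-punchIn {suc m} {L} B (suc j) = begin
    undefCount {L = L} B
      ≡⟨ undefCount-suc B ⟩
    countUndef (B zero) + undefCount {L = L ∘ suc} (B ∘ suc)
      ≡⟨ cong (countUndef (B zero) +_) (undefCount-punchIn (B ∘ suc) j) ⟩
    countUndef (B zero) + (countUndef (B (suc j)) + rest)
      ≡⟨ x∙yz≈y∙xz (countUndef (B zero)) (countUndef (B (suc j))) rest ⟩
    countUndef (B (suc j)) + (countUndef (B zero) + rest)
      ≡⟨ cong (countUndef (B (suc j)) +_) (sym (undefCount-suc (SpB {L = L} (suc j) B))) ⟩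
    countUndef (B (suc j)) + undefCount {L = SpL L (suc j)} (SpB {L = L} (suc j) B)
      ∎
    where
    open ≡-Reasoning
    rest : ℕ
    rest = undefCount {L = SpL (L ∘ suc) j} (SpB {L = L ∘ suc} j (B ∘ suc))

  module _ {m} {L : Fin (suc m) → CompleteLattice c ℓ₁ ℓ₂} (j : Fin (suc m)) where
    private module L k = CompleteLattice (L k)

    SpB-bind-self : ∀ (B : Binding L) a h → SpB {L = L} j (bind {L = L} B j a) h ≡ SpB {L = L} j B h
    SpB-bind-self B a h = bind-≢ B a (punchInᵢ≢i j h ∘ sym)

    undefCount-bind-self : ∀ (B : Binding L) a →
                           undefCount {L = L} (bind {L = L} B j a) ≡ undefCount {L = SpL L j} (SpB {L = L} j B)
    undefCount-bind-self B a = begin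
      undefCount {L = L} (bind {L = L} B j a)
        ≡⟨ undefCount-punchIn (bind {L = L} B j a) j ⟩
      countUndef (bind {L = L} B j a j) + undefCount {L = SpL L j} (SpB {L = L} j (bind {L = L} B j a))
        ≡⟨ cong₂ (λ b n → countUndef b + n) (bind-≡ B j a) (undefCount-cong _ _ (SpB-bind-self B a)) ⟩
      undefCount {L = SpL L j} (SpB {L = L} j B)
        ∎
      where open ≡-Reasoning

    SpB-bind : ∀ (B : Binding L) (B′ : Binding (SpL L j)) → (∀ h → B′ h ≡ SpB {L = L} j B h) →
               ∀ i′ x h → bind {L = SpL L j} B′ i′ x h ≡ SpB {L = L} j (bind {L = L} B (punchIn j i′) x) h
    SpB-bind B B′ B′≡SpB i′ x h with i′ ≟ h
    ... | yes refl = sym (bind-≡ B (punchIn j i′) x)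
    ... | no i′≢h  = trans (B′≡SpB h) (sym (bind-≢ B x (i′≢h ∘ punchIn-injective j i′ h)))

    ≈-E : ∀ a (w : Prod L) (y : Prod (SpL L j)) → L._≈_ j (w j) a →
          (∀ h → L._≈_ (punchIn j h) (w (punchIn j h)) (y h)) → ∀ k → L._≈_ k (w k) (E L j a y k)
    ≈-E a w y wj≈a w≈y k with j ≟ k
    ... | yes refl = wj≈a
    ... | no _     = ≈-subst _ _
      where
      ≈-subst : ∀ {k} h (eq : punchIn j h ≡ k) → L._≈_ k (w k) (subst (λ k′ → Carrier (L k′)) eq (y h))
      ≈-subst h refl = w≈y h

    module _ (f : Prod L → Prod L) (mono : Monotone {L = L} f) (a : Carrier (L j)) where

      nestedF-Sp : ∀ F (B : Binding L) (B′ : Binding (SpL L j)) → B j ≡ just a →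
                   (∀ h → B′ h ≡ SpB {L = L} j B h) → ∀ i′ →
                   L._≈_ (punchIn j i′) (nestedF L f F (punchIn j i′) B) (nestedF (SpL L j) (Sp L j a f) F i′ B′)
      nestedF-Sp zero    B B′ Bj≡a B′≡SpB i′ = L.Eq.refl (punchIn j i′)
      nestedF-Sp (suc F) B B′ Bj≡a B′≡SpB i′ =
        μ-cong (L (punchIn j i′)) _ _ λ x →
          monotone⇒cong {L = L} f mono _ _ (≈-E a _ _ (v-at-j x) (v-off-j x)) (punchIn j i′)
        where
        v-at-j : ∀ x → L._≈_ j (vecF L f F (punchIn j i′) B x j) a
        v-at-j x = L.Eq.reflexive j
          (trans (vecF-≢ f F B x (punchInᵢ≢i j i′)) (cong (maybe′ (λ b → b) _) Bj≡a))

        v-off-j : ∀ x h → L._≈_ (punchIn j h) (vecF L f F (punchIn j i′) B x (punchIn j h))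
                                              (vecF (SpL L j) (Sp L j a f) F i′ B′ x h)
        v-off-j x h with i′ ≟ h
        ... | yes refl = L.Eq.reflexive (punchIn j i′) (vecF-≡ f F (punchIn j i′) B x)
        ... | no i′≢h rewrite B′≡SpB h = L.Eq.trans (punchIn j h)
          (L.Eq.reflexive (punchIn j h) (vecF-≢ f F B x (i′≢h ∘ punchIn-injective j i′ h)))
          (maybe′-cong (L (punchIn j h)) (B (punchIn j h))
            (nestedF-Sp F _ _ (trans (bind-≢ B x (punchInᵢ≢i j i′)) Bj≡a) (SpB-bind B B′ B′≡SpB i′ x) h))

lemma1 : ∀ {c ℓ₁ ℓ₂ : Level} (m : ℕ) → 0 < m →
         (L : Fin (suc m) → CompleteLattice c ℓ₁ ℓ₂) →
         (f : Prod L → Prod L) → Monotone {L = L} f →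
         (B : Binding L) (j : Fin (suc m)) (a : Carrier (L j)) (i′ : Fin m) →
         CompleteLattice._≈_ (L (punchIn j i′))
           (nested L f (punchIn j i′) (bind {L = L} B j a))
           (nested (SpL L j) (Sp L j a f) i′ (SpB {L = L} j B))
lemma1 m _ L f mono B j a i′ =
  subst (λ F → nestedF L f (suc F) (punchIn j i′) (bind {L = L} B j a)
                 ≈ nested (SpL L j) (Sp L j a f) i′ (SpB {L = L} j B))
    (sym (undefCount-bind-self {L = L} j B a))
    (nestedF-Sp {L = L} j f mono a (suc (undefCount {L = SpL L j} (SpB {L = L} j B)))
      (bind {L = L} B j a) (SpB {L = L} j B) (bind-≡ B j a) (sym ∘ SpB-bind-self j B a) i′)
  where open CompleteLattice (L (punchIn j i′)) using (_≈_)
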